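{- Let $a,b,m\in\mathbb{N}$. Then, as formal power series in $q$, $$\sum_{n=0}^\infty \left(\mathrm{cp}_{a,b,m}^e(n)-\mathrm{cp}_{a,b,m}^o(n)\right)q^n=\frac{(-q^{a+b};q^m)_\infty}{(-q^a;q^m)_\infty(q^b;q^m)_\infty}.$$
   Context: A partition of $n$ is a non-increasing finite sequence of positive integers summing to $n$; $\nu(\lambda)$ denotes its number of parts and $|\lambda|$ its sum. For $a,b,m\in\mathbb{N}$, an $(a,b,m)$-copartition is a triple of partitions $(\gamma,\rho,\sigma)$ such that every part of $\gamma$ (the "ground") is $\equiv a \pmod m$ and at least $a$, every part of $\sigma$ (the "sky") is $\equiv b\pmod m$ and at least $b$, and $\rho$ consists of exactly $\nu(\sigma)$ parts each equal to $m\cdot\nu(\gamma)$ (these parts are $0$ and contribute nothing when $\gamma$ is empty). Its size is $|\gamma|+|\rho|+|\sigma|$. $\mathrm{cp}^o_{a,b,m}(n)$ (resp. $\mathrm{cp}^e_{a,b,m}(n)$) is the number of $(a,b,m)$-copartitions of size $n$ whose ground $\gamma$ has an odd (resp. even) number of parts. Notation: $(x;q)_\infty=\prod_{k\ge0}(1-xq^k)$. -}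

module Defs where

open import Data.Bool using (if_then_else_)
open import Data.Nat using (ℕ; zero; suc; _+_; _*_; _∸_; _≤_; _≥_; _%_; _≡ᵇ_)
open import Data.Integer using (ℤ; +_; -_; _^_) renaming (_+_ to _+ℤ_; _*_ to _*ℤ_)
open import Data.List using (List; length; replicate)
open import Data.Nat.ListAction using (sum)
open import Data.List.Relation.Unary.All using (All)
open import Data.List.Relation.Unary.Linked using (Linked)
open import Data.Nat.Divisibility using (_∣_)
open import Data.Product using (Σ; _×_)
open import Relation.Binary.PropositionalEquality using (_≡_)

IsPartition : List ℕ → Set
IsPartition xs = Linked _≥_ xs × All (λ x → 1 ≤ x) xs

CongAtLeast : ℕ → ℕ → ℕ → Set
CongAtLeast r m x = r ≤ x × m ∣ (x ∸ r)

record Copartition (a b m : ℕ) : Set where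
  field
    ground     : List ℕ
    rho        : List ℕ
    sky        : List ℕ
    groundPart : IsPartition ground
    groundCong : All (CongAtLeast a m) ground
    skyPart    : IsPartition sky
    skyCong    : All (CongAtLeast b m) sky
    rhoDef     : rho ≡ replicate (length sky) (m * length ground)

open Copartition public

size : ∀ {a b m} → Copartition a b m → ℕ
size c = sum (ground c) + sum (rho c) + sum (sky c)

CPe : ℕ → ℕ → ℕ → ℕ → Set
CPe a b m n = Σ (Copartition a b m) λ c → size c ≡ n × length (ground c) % 2 ≡ 0

CPo : ℕ → ℕ → ℕ → ℕ → Set
CPo a b m n = Σ (Copartition a b m) λ c → size c ≡ n × length (ground c) % 2 ≡ 1

Series : Set
Series = ℕ → ℤ

sumTo : ℕ → (ℕ → ℤ) → ℤ
sumTo zero    f = f 0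
sumTo (suc n) f = sumTo n f +ℤ f (suc n)

_⊛_ : Series → Series → Series
(f ⊛ g) n = sumTo n (λ i → f i *ℤ g (n ∸ i))

oneS : Series
oneS n = if n ≡ᵇ 0 then + 1 else + 0

prodTo : ℕ → (ℕ → Series) → Series
prodTo zero    F = oneS
prodTo (suc N) F = prodTo N F ⊛ F N

-- Infinite product ∏_{k ≥ 0} F k, for factors with F k ≡ 1 mod q^(k+1)
-- (true for all uses below since all exponents are ≥ k+1): the
-- coefficient of q^n is already determined by the first n+1 factors.
infProd : (ℕ → Series) → Series
infProd F n = prodTo (suc n) F n

linFactor : ℤ → ℕ → Series
linFactor s e n = (if n ≡ᵇ 0 then + 1 else + 0) +ℤ (if n ≡ᵇ e then s else + 0)

-- the series 1/(1 - s q^e) = Σ_j s^j q^(j e)   (e ≥ 1)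
geoFactor : ℤ → ℕ → Series
geoFactor s e n = sumTo n (λ j → if (j * e) ≡ᵇ n then s ^ j else + 0)

qPoch : ℤ → ℕ → ℕ → Series
qPoch c e m = infProd (λ k → linFactor (- c) (e + k * m))

qPochInv : ℤ → ℕ → ℕ → Series
qPochInv c e m = infProd (λ k → geoFactor c (e + k * m))

rhsSeries : ℕ → ℕ → ℕ → Series
rhsSeries a b m = qPoch (- + 1) (a + b) m ⊛ (qPochInv (- + 1) a m ⊛ qPochInv (+ 1) b m)

-- Write R a b for the right-hand side. Pulling the factor 1 + q^(a+b) out of the numerator
-- and splitting it as (1 + q^a) - q^a (1 - q^b), resp. (1 - q^b) + q^b (1 + q^a), gives
--   R a b = R (a+m) b - q^a R a (b+m)   and   R a b = R a (b+m) + q^b R (a+m) b.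
-- Copartitions obey the same recurrences. Either all ground parts exceed a, or the smallest
-- one equals a; removing it flips the parity of the ground and lowers each ρ-part by m, which
-- is compensated by raising each sky part by m, so what remains is an (a, b+m)-copartition of
-- n - a. Peeling the smallest sky part likewise raises the ground parts by m and keeps the
-- parity. For n < a, b only the empty copartition exists, so induction on n, and for fixed n
-- upward induction on a and b past n, matches the two sides coefficient by coefficient.
{-# OPTIONS --safe #-}
module Submission where

open import Defs
open import Data.Nat using (ℕ)
open import Data.Integer using (+_; _-_)
open import Data.Fin using (Fin)
open import Data.Product using (∃₂; _×_)
open import Function.Bundles using (_↔_)
open import Relation.Binary.PropositionalEquality using (_≡_)

open import Level using (0ℓ)
open import Function using (_∘_; flip)
open import Data.Bool using (true; false; if_then_else_)
open import Data.Empty using (⊥-elim)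
open import Data.Sum using (_⊎_; inj₁; inj₂)
open import Data.Product using (Σ; _,_; proj₁; proj₂; ∃-syntax; Σ-syntax; uncurry)
open import Data.Nat
  using (zero; suc; _+_; _*_; _∸_; _≤_; _<_; _≥_; _≤?_; z≤n; s≤s; _≡ᵇ_; _%_)
open import Data.Nat using (NonZero; >-nonZero; >-nonZero⁻¹)
import Data.Nat.Properties as ℕ
open import Data.Nat.DivMod using (m%n<n)
open import Data.Nat.Divisibility using (divides)
open import Data.Nat.Induction using (<-rec)
open import Data.Nat.ListAction using (sum)
open import Data.Nat.ListAction.Properties using (sum-++)
import Data.Nat.Solver
open import Data.Integer using (ℤ; -_; _^_) renaming (_+_ to _+ℤ_; _*_ to _*ℤ_)
import Data.Integer.Properties as ℤ
import Data.Integer.Solver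
open import Algebra.Properties.CommutativeSemigroup ℕ.+-commutativeSemigroup using (xy∙z≈xz∙y)
open import Algebra.Properties.CommutativeSemigroup ℤ.+-commutativeSemigroup using (interchange)
import Data.Fin as Fin
import Data.Fin.Properties as Fin
open import Data.List using (List; []; _∷_; _∷ʳ_; map; length; replicate)
import Data.List.Properties as LP
open import Data.List.Relation.Unary.All using (All; []; _∷_)
import Data.List.Relation.Unary.All as All
import Data.List.Relation.Unary.All.Properties as All
open import Data.List.Relation.Unary.Linked using (Linked; []; [-]; _∷_)
import Data.List.Relation.Unary.Linked as Linked
import Data.List.Relation.Unary.Linked.Properties as Linked
open import Function.Bundles using (mk↔ₛ′)
open import Function.Properties.Inverse using (↔-refl; ↔-trans; ↔-sym)
open import Data.Sum.Function.Propositional using (_⊎-↔_)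
open import Relation.Binary.Bundles using (Setoid)
open import Relation.Binary.PropositionalEquality
  using (_≢_; refl; sym; trans; cong; cong₂; subst; subst₂; _→-setoid_; module ≡-Reasoning)
import Relation.Binary.Reasoning.Setoid as SetoidReasoning
open import Relation.Nullary using (¬_; yes; no; Irrelevant)
import Relation.Unary as U

-- Finite sums

sumTo-cong : ∀ n {f g : ℕ → ℤ} → (∀ i → i ≤ n → f i ≡ g i) → sumTo n f ≡ sumTo n g
sumTo-cong zero    f≡g = f≡g 0 z≤n
sumTo-cong (suc n) f≡g =
  cong₂ _+ℤ_ (sumTo-cong n (λ i i≤n → f≡g i (ℕ.m≤n⇒m≤1+n i≤n))) (f≡g (suc n) ℕ.≤-refl)

sumTo-head : ∀ n (f : ℕ → ℤ) → sumTo (suc n) f ≡ f 0 +ℤ sumTo n (λ i → f (suc i))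
sumTo-head zero    f = refl
sumTo-head (suc n) f = trans (cong (_+ℤ f (suc (suc n))) (sumTo-head n f))
  (ℤ.+-assoc (f 0) (sumTo n (λ i → f (suc i))) (f (suc (suc n))))

sumTo-zero : ∀ n {f : ℕ → ℤ} → (∀ i → i ≤ n → f i ≡ + 0) → sumTo n f ≡ + 0
sumTo-zero zero    f≡0 = f≡0 0 z≤n
sumTo-zero (suc n) f≡0 =
  cong₂ _+ℤ_ (sumTo-zero n (λ i i≤n → f≡0 i (ℕ.m≤n⇒m≤1+n i≤n))) (f≡0 (suc n) ℕ.≤-refl)

sumTo-extend : ∀ {n} N (f : ℕ → ℤ) → n ≤ N → (∀ i → n < i → f i ≡ + 0) →
  sumTo N f ≡ sumTo n f
sumTo-extend N f n≤N f≡0 with ℕ.m≤n⇒m<n∨m≡n n≤N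
... | inj₂ refl = refl
sumTo-extend (suc N) f _ f≡0 | inj₁ (s≤s n≤N) =
  trans (cong₂ _+ℤ_ (sumTo-extend N f n≤N f≡0) (f≡0 (suc N) (s≤s n≤N))) (ℤ.+-identityʳ _)

sumTo-+ : ∀ n (f g : ℕ → ℤ) → sumTo n (λ i → f i +ℤ g i) ≡ sumTo n f +ℤ sumTo n g
sumTo-+ zero    f g = refl
sumTo-+ (suc n) f g = trans (cong (_+ℤ (f (suc n) +ℤ g (suc n))) (sumTo-+ n f g))
  (interchange (sumTo n f) (sumTo n g) (f (suc n)) (g (suc n)))

sumTo-*ˡ : ∀ n c (f : ℕ → ℤ) → sumTo n (λ i → c *ℤ f i) ≡ c *ℤ sumTo n f
sumTo-*ˡ zero    c f = refl
sumTo-*ˡ (suc n) c f = trans (cong (_+ℤ (c *ℤ f (suc n))) (sumTo-*ˡ n c f))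
  (sym (ℤ.*-distribˡ-+ c (sumTo n f) (f (suc n))))

sumTo-*ʳ : ∀ n c (f : ℕ → ℤ) → sumTo n (λ i → f i *ℤ c) ≡ sumTo n f *ℤ c
sumTo-*ʳ n c f = trans (sumTo-cong n (λ i _ → ℤ.*-comm (f i) c))
  (trans (sumTo-*ˡ n c f) (ℤ.*-comm c (sumTo n f)))

sumTo-reverse : ∀ n (f : ℕ → ℤ) → sumTo n f ≡ sumTo n (λ i → f (n ∸ i))
sumTo-reverse zero    f = refl
sumTo-reverse (suc n) f = begin
  sumTo (suc n) f
    ≡⟨ sumTo-head n f ⟩
  f 0 +ℤ sumTo n (λ i → f (suc i))
    ≡⟨ cong (f 0 +ℤ_) (sumTo-reverse n (λ i → f (suc i))) ⟩
  f 0 +ℤ sumTo n (λ i → f (suc (n ∸ i)))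
    ≡⟨ ℤ.+-comm (f 0) _ ⟩
  sumTo n (λ i → f (suc (n ∸ i))) +ℤ f 0
    ≡⟨ cong₂ (λ s i → s +ℤ f i)
         (sumTo-cong n (λ i i≤n → cong f (sym (ℕ.+-∸-assoc 1 i≤n)))) (sym (ℕ.n∸n≡0 n)) ⟩
  sumTo (suc n) (λ i → f (suc n ∸ i)) ∎
  where open ≡-Reasoning

sumTo-triangle : ∀ n (F : ℕ → ℕ → ℤ) →
  sumTo n (λ i → sumTo (n ∸ i) (F i)) ≡ sumTo n (λ k → sumTo k (λ i → F i (k ∸ i)))
sumTo-triangle zero    F = refl
sumTo-triangle (suc n) F = begin
  sumTo (suc n) (λ i → sumTo (suc n ∸ i) (F i))
    ≡⟨ sumTo-head n _ ⟩
  sumTo (suc n) (F 0) +ℤ sumTo n (λ i → sumTo (n ∸ i) (F (suc i)))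
    ≡⟨ cong₂ _+ℤ_ (sumTo-head n (F 0)) (sumTo-triangle n (λ i → F (suc i))) ⟩
  (F 0 0 +ℤ sumTo n (λ k → F 0 (suc k))) +ℤ sumTo n G
    ≡⟨ ℤ.+-assoc (F 0 0) _ _ ⟩
  F 0 0 +ℤ (sumTo n (λ k → F 0 (suc k)) +ℤ sumTo n G)
    ≡⟨ cong (F 0 0 +ℤ_) (sym (sumTo-+ n _ G)) ⟩
  F 0 0 +ℤ sumTo n (λ k → F 0 (suc k) +ℤ G k)
    ≡⟨ cong (F 0 0 +ℤ_) (sumTo-cong n (λ k _ → sym (sumTo-head k (λ i → F i (suc k ∸ i))))) ⟩
  F 0 0 +ℤ sumTo n (λ k → sumTo (suc k) (λ i → F i (suc k ∸ i)))
    ≡⟨ sym (sumTo-head n _) ⟩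
  sumTo (suc n) (λ k → sumTo k (λ i → F i (k ∸ i))) ∎
  where
  open ≡-Reasoning
  G : ℕ → ℤ
  G k = sumTo k (λ i → F (suc i) (k ∸ i))

-- Formal power series

Series-setoid : Setoid 0ℓ 0ℓ
Series-setoid = ℕ →-setoid ℤ

open Setoid Series-setoid using (_≈_) renaming (refl to ≈-refl; sym to ≈-sym; trans to ≈-trans)
module ≈-Reasoning = SetoidReasoning Series-setoid

infixl 6 _⊕_
_⊕_ : Series → Series → Series
(f ⊕ g) n = f n +ℤ g n

⊕-cong : ∀ {f f′ g g′} → f ≈ f′ → g ≈ g′ → f ⊕ g ≈ f′ ⊕ g′
⊕-cong f≈f′ g≈g′ n = cong₂ _+ℤ_ (f≈f′ n) (g≈g′ n)

monomial : ℤ → ℕ → Series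
monomial s e n = if n ≡ᵇ e then s else + 0

⊛-cong-upTo : ∀ n {f f′ g g′ : Series} →
  (∀ i → i ≤ n → f i ≡ f′ i) → (∀ i → i ≤ n → g i ≡ g′ i) → (f ⊛ g) n ≡ (f′ ⊛ g′) n
⊛-cong-upTo n f≡f′ g≡g′ =
  sumTo-cong n (λ i i≤n → cong₂ _*ℤ_ (f≡f′ i i≤n) (g≡g′ (n ∸ i) (ℕ.m∸n≤m n i)))

⊛-cong : ∀ {f f′ g g′} → f ≈ f′ → g ≈ g′ → f ⊛ g ≈ f′ ⊛ g′
⊛-cong f≈f′ g≈g′ n = ⊛-cong-upTo n (λ i _ → f≈f′ i) (λ i _ → g≈g′ i)

⊛-congˡ : ∀ f {g g′} → g ≈ g′ → f ⊛ g ≈ f ⊛ g′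
⊛-congˡ f = ⊛-cong {f} {f} (λ _ → refl)

⊛-congʳ : ∀ {f f′} g → f ≈ f′ → f ⊛ g ≈ f′ ⊛ g
⊛-congʳ {f} {f′} g f≈f′ = ⊛-cong {f} {f′} {g} {g} f≈f′ (λ _ → refl)

⊛-comm : ∀ f g → f ⊛ g ≈ g ⊛ f
⊛-comm f g n = trans (sumTo-reverse n _) (sumTo-cong n (λ i i≤n →
  trans (cong (λ j → f (n ∸ i) *ℤ g j) (ℕ.m∸[m∸n]≡n i≤n)) (ℤ.*-comm (f (n ∸ i)) (g i))))

⊛-assoc : ∀ f g h → (f ⊛ g) ⊛ h ≈ f ⊛ (g ⊛ h)
⊛-assoc f g h n = begin
  sumTo n (λ k → sumTo k (λ i → f i *ℤ g (k ∸ i)) *ℤ h (n ∸ k))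
    ≡⟨ sumTo-cong n (λ k _ → trans (sym (sumTo-*ʳ k _ _)) (sumTo-cong k (λ i i≤k →
         trans (ℤ.*-assoc (f i) (g (k ∸ i)) (h (n ∸ k)))
           (cong (λ j → f i *ℤ (g (k ∸ i) *ℤ h j)) (sym (∸-∸ i≤k)))))) ⟩
  sumTo n (λ k → sumTo k (λ i → f i *ℤ (g (k ∸ i) *ℤ h (n ∸ i ∸ (k ∸ i)))))
    ≡⟨ sym (sumTo-triangle n (λ i j → f i *ℤ (g j *ℤ h (n ∸ i ∸ j)))) ⟩
  sumTo n (λ i → sumTo (n ∸ i) (λ j → f i *ℤ (g j *ℤ h (n ∸ i ∸ j))))
    ≡⟨ sumTo-cong n (λ i _ → sumTo-*ˡ (n ∸ i) (f i) _) ⟩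
  sumTo n (λ i → f i *ℤ sumTo (n ∸ i) (λ j → g j *ℤ h (n ∸ i ∸ j))) ∎
  where
  open ≡-Reasoning
  ∸-∸ : ∀ {i k} → i ≤ k → n ∸ i ∸ (k ∸ i) ≡ n ∸ k
  ∸-∸ {i} {k} i≤k = trans (ℕ.∸-+-assoc n i (k ∸ i)) (cong (n ∸_) (ℕ.m+[n∸m]≡n i≤k))

⊛-distribʳ-⊕ : ∀ f g h → (f ⊕ g) ⊛ h ≈ f ⊛ h ⊕ g ⊛ h
⊛-distribʳ-⊕ f g h n =
  trans (sumTo-cong n (λ i _ → ℤ.*-distribʳ-+ (h (n ∸ i)) (f i) (g i))) (sumTo-+ n _ _)

⊛-distribˡ-⊕ : ∀ f g h → h ⊛ (f ⊕ g) ≈ h ⊛ f ⊕ h ⊛ g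
⊛-distribˡ-⊕ f g h n =
  trans (sumTo-cong n (λ i _ → ℤ.*-distribˡ-+ (h i) (f (n ∸ i)) (g (n ∸ i)))) (sumTo-+ n _ _)

⊛-lcomm : ∀ f g h → f ⊛ (g ⊛ h) ≈ g ⊛ (f ⊛ h)
⊛-lcomm f g h = begin
  f ⊛ (g ⊛ h)  ≈⟨ ≈-sym (⊛-assoc f g h) ⟩
  (f ⊛ g) ⊛ h  ≈⟨ ⊛-congʳ h (⊛-comm f g) ⟩
  (g ⊛ f) ⊛ h  ≈⟨ ⊛-assoc g f h ⟩
  g ⊛ (f ⊛ h)  ∎
  where open ≈-Reasoning

≡ᵇ-refl : ∀ e → (e ≡ᵇ e) ≡ true
≡ᵇ-refl zero    = refl
≡ᵇ-refl (suc e) = ≡ᵇ-refl e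

≢⇒≡ᵇ-false : ∀ {i e} → i ≢ e → (i ≡ᵇ e) ≡ false
≢⇒≡ᵇ-false {zero}  {zero}  i≢e = ⊥-elim (i≢e refl)
≢⇒≡ᵇ-false {zero}  {suc e} i≢e = refl
≢⇒≡ᵇ-false {suc i} {zero}  i≢e = refl
≢⇒≡ᵇ-false {suc i} {suc e} i≢e = ≢⇒≡ᵇ-false (i≢e ∘ cong suc)

+-≡ᵇ-cancelˡ : ∀ e x y → ((e + x) ≡ᵇ (e + y)) ≡ (x ≡ᵇ y)
+-≡ᵇ-cancelˡ zero    x y = refl
+-≡ᵇ-cancelˡ (suc e) x y = +-≡ᵇ-cancelˡ e x y

monomial-≢ : ∀ s {e i} → i ≢ e → monomial s e i ≡ + 0
monomial-≢ s i≢e = cong (if_then s else + 0) (≢⇒≡ᵇ-false i≢e)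

sumTo-monomial-< : ∀ n s e (h : ℕ → ℤ) → n < e →
  sumTo n (λ i → monomial s e i *ℤ h i) ≡ + 0
sumTo-monomial-< n s e h n<e = sumTo-zero n (λ i i≤n →
  cong (_*ℤ h i) (monomial-≢ s (ℕ.<⇒≢ (ℕ.≤-<-trans i≤n n<e))))

sumTo-monomial-≥ : ∀ n s e (h : ℕ → ℤ) → e ≤ n →
  sumTo n (λ i → monomial s e i *ℤ h i) ≡ s *ℤ h e
sumTo-monomial-≥ n s e h e≤n = trans
  (sumTo-extend n _ e≤n (λ i e<i → cong (_*ℤ h i) (monomial-≢ s (ℕ.>⇒≢ e<i))))
  (at-top e)
  where
  at-top : ∀ e → sumTo e (λ i → monomial s e i *ℤ h i) ≡ s *ℤ h e
  at-top zero    = refl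
  at-top (suc e) rewrite ≡ᵇ-refl e =
    trans (cong (_+ℤ s *ℤ h (suc e)) (sumTo-monomial-< e s (suc e) h ℕ.≤-refl)) (ℤ.+-identityˡ _)

monomial-⊛-< : ∀ s e f n → n < e → (monomial s e ⊛ f) n ≡ + 0
monomial-⊛-< s e f n = sumTo-monomial-< n s e (λ i → f (n ∸ i))

monomial-⊛-≥ : ∀ s e f n → e ≤ n → (monomial s e ⊛ f) n ≡ s *ℤ f (n ∸ e)
monomial-⊛-≥ s e f n = sumTo-monomial-≥ n s e (λ i → f (n ∸ i))

⊛-identityˡ : ∀ f → oneS ⊛ f ≈ f
⊛-identityˡ f n = trans (monomial-⊛-≥ (+ 1) 0 f n z≤n) (ℤ.*-identityˡ (f n))

⊛-identityʳ : ∀ f → f ⊛ oneS ≈ f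
⊛-identityʳ f = ≈-trans (⊛-comm f oneS) (⊛-identityˡ f)

monomial-⊛-monomial : ∀ s t d e → monomial s d ⊛ monomial t e ≈ monomial (s *ℤ t) (d + e)
monomial-⊛-monomial s t d e n with d ≤? n
... | no d≰n = trans (monomial-⊛-< s d (monomial t e) n (ℕ.≰⇒> d≰n))
  (sym (monomial-≢ (s *ℤ t) (ℕ.<⇒≢ (ℕ.<-≤-trans (ℕ.≰⇒> d≰n) (ℕ.m≤m+n d e)))))
... | yes d≤n =
  trans (monomial-⊛-≥ s d (monomial t e) n d≤n) (shifted (n ∸ d) (ℕ.m+[n∸m]≡n d≤n))
  where
  shifted : ∀ r → d + r ≡ n → s *ℤ monomial t e r ≡ monomial (s *ℤ t) (d + e) n
  shifted r refl rewrite +-≡ᵇ-cancelˡ d r e with r ≡ᵇ e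
  ... | true  = refl
  ... | false = ℤ.*-zeroʳ s

-- Infinite products

OneUpTo : ℕ → Series → Set
OneUpTo N f = ∀ i → i ≤ N → f i ≡ oneS i

⊛-OneUpToʳ : ∀ {N} f {g} → OneUpTo N g → ∀ n → n ≤ N → (f ⊛ g) n ≡ f n
⊛-OneUpToʳ f {g} g≈1 n n≤N = trans (⊛-comm f g n) (trans
  (⊛-cong-upTo n {g} {oneS} {f} {f} (λ i i≤n → g≈1 i (ℕ.≤-trans i≤n n≤N)) (λ _ _ → refl))
  (⊛-identityˡ f n))

⊛-OneUpTo : ∀ {N f g} → OneUpTo N f → OneUpTo N g → OneUpTo N (f ⊛ g)
⊛-OneUpTo {f = f} f≈1 g≈1 i i≤N = trans (⊛-OneUpToʳ f g≈1 i i≤N) (f≈1 i i≤N)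

prodTo-OneUpTo : ∀ {M} N F → (∀ k → OneUpTo M (F k)) → OneUpTo M (prodTo N F)
prodTo-OneUpTo zero    F F≈1 i _ = refl
prodTo-OneUpTo (suc N) F F≈1     = ⊛-OneUpTo (prodTo-OneUpTo N F F≈1) (F≈1 N)

infProd-OneUpTo : ∀ {M} F → (∀ k → OneUpTo M (F k)) → OneUpTo M (infProd F)
infProd-OneUpTo F F≈1 i = prodTo-OneUpTo (suc i) F F≈1 i

ConvergentFactors : (ℕ → Series) → Set
ConvergentFactors F = ∀ k → OneUpTo k (F k)

prodTo-stable : ∀ {F} → ConvergentFactors F → ∀ N i → i < N → prodTo N F i ≡ infProd F i
prodTo-stable {F} conv (suc N) i (s≤s i≤N) with ℕ.m≤n⇒m<n∨m≡n i≤N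
... | inj₁ i<N  = trans (⊛-OneUpToʳ (prodTo N F) (conv N) i i≤N) (prodTo-stable conv N i i<N)
... | inj₂ refl = refl

prodTo-cong : ∀ N {F G} → (∀ k → F k ≈ G k) → prodTo N F ≈ prodTo N G
prodTo-cong zero    F≈G = ≈-refl
prodTo-cong (suc N) F≈G = ⊛-cong (prodTo-cong N F≈G) (F≈G N)

infProd-cong : ∀ {F G} → (∀ k → F k ≈ G k) → infProd F ≈ infProd G
infProd-cong F≈G n = prodTo-cong (suc n) F≈G n

prodTo-uncons : ∀ N F → prodTo (suc N) F ≈ F 0 ⊛ prodTo N (λ k → F (suc k))
prodTo-uncons zero    F = ≈-trans (⊛-identityˡ (F 0)) (≈-sym (⊛-identityʳ (F 0)))
prodTo-uncons (suc N) F = begin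
  prodTo (suc N) F ⊛ F (suc N)
    ≈⟨ ⊛-congʳ (F (suc N)) (prodTo-uncons N F) ⟩
  (F 0 ⊛ prodTo N (λ k → F (suc k))) ⊛ F (suc N)
    ≈⟨ ⊛-assoc (F 0) (prodTo N (λ k → F (suc k))) (F (suc N)) ⟩
  F 0 ⊛ prodTo (suc N) (λ k → F (suc k)) ∎
  where open ≈-Reasoning

infProd-uncons : ∀ F → ConvergentFactors F → infProd F ≈ F 0 ⊛ infProd (λ k → F (suc k))
infProd-uncons F conv n = begin
  prodTo (suc n) F n
    ≡⟨ sym (prodTo-stable conv (suc (suc n)) n (ℕ.m<n⇒m<1+n (ℕ.n<1+n n))) ⟩
  prodTo (suc (suc n)) F n
    ≡⟨ prodTo-uncons (suc n) F n ⟩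
  (F 0 ⊛ prodTo (suc n) F₊) n
    ≡⟨ ⊛-cong-upTo n {F 0} {F 0} {prodTo (suc n) F₊} {infProd F₊}
         (λ _ _ → refl) (λ j j≤n → prodTo-stable conv₊ (suc n) j (s≤s j≤n)) ⟩
  (F 0 ⊛ infProd F₊) n ∎
  where
  open ≡-Reasoning
  F₊ : ℕ → Series
  F₊ k = F (suc k)
  conv₊ : ConvergentFactors F₊
  conv₊ k i i≤k = conv (suc k) i (ℕ.m≤n⇒m≤1+n i≤k)

linFactor-OneUpTo : ∀ s {e k} → k < e → OneUpTo k (linFactor s e)
linFactor-OneUpTo s k<e i i≤k =
  trans (cong (oneS i +ℤ_) (monomial-≢ s (ℕ.<⇒≢ (ℕ.≤-<-trans i≤k k<e)))) (ℤ.+-identityʳ _)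

geoTerm : ℤ → ℕ → ℕ → ℕ → ℤ
geoTerm c e n j = if j * e ≡ᵇ n then c ^ j else + 0

geoTerm-> : ∀ c e n j → n < j * e → geoTerm c e n j ≡ + 0
geoTerm-> c e n j n<je = cong (if_then c ^ j else + 0) (≢⇒≡ᵇ-false (ℕ.>⇒≢ n<je))

geoFactor-OneUpTo : ∀ c {e k} → k < e → OneUpTo k (geoFactor c e)
geoFactor-OneUpTo c     k<e zero    _   = refl
geoFactor-OneUpTo c {e} k<e (suc i) i<k =
  trans (sumTo-head i (geoTerm c e (suc i))) (trans (ℤ.+-identityˡ _) (sumTo-zero i (λ j _ →
    geoTerm-> c e (suc i) (suc j) (ℕ.<-≤-trans (ℕ.<-≤-trans (s≤s i<k) k<e) (ℕ.m≤n*m e (suc j))))))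

geoFactor-extend : ∀ c {e} → 1 ≤ e → ∀ {n} N → n ≤ N →
  sumTo N (geoTerm c e n) ≡ geoFactor c e n
geoFactor-extend c {suc e} _ N n≤N =
  sumTo-extend N _ n≤N (λ j n<j → geoTerm-> c (suc e) _ j (ℕ.<-≤-trans n<j (ℕ.m≤m*n j (suc e))))

geoFactor-step : ∀ c {e} → 1 ≤ e → ∀ r → geoFactor c e (e + r) ≡ c *ℤ geoFactor c e r
geoFactor-step c {e@(suc e′)} 1≤e r = begin
  sumTo (e + r) (geoTerm c e (e + r))
    ≡⟨ sumTo-head (e′ + r) _ ⟩
  + 0 +ℤ sumTo (e′ + r) (λ j → geoTerm c e (e + r) (suc j))
    ≡⟨ ℤ.+-identityˡ _ ⟩
  sumTo (e′ + r) (λ j → geoTerm c e (e + r) (suc j))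
    ≡⟨ sumTo-cong (e′ + r) (λ j _ → shifted j) ⟩
  sumTo (e′ + r) (λ j → c *ℤ geoTerm c e r j)
    ≡⟨ sumTo-*ˡ (e′ + r) c _ ⟩
  c *ℤ sumTo (e′ + r) (geoTerm c e r)
    ≡⟨ cong (c *ℤ_) (geoFactor-extend c 1≤e (e′ + r) (ℕ.m≤n+m r e′)) ⟩
  c *ℤ geoFactor c e r ∎
  where
  open ≡-Reasoning
  shifted : ∀ j → geoTerm c e (e + r) (suc j) ≡ c *ℤ geoTerm c e r j
  shifted j rewrite +-≡ᵇ-cancelˡ e (j * e) r with j * e ≡ᵇ r
  ... | true  = refl
  ... | false = sym (ℤ.*-zeroʳ c)

linFactor-⊛-geoFactor : ∀ c {e} → 1 ≤ e → linFactor (- c) e ⊛ geoFactor c e ≈ oneS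
linFactor-⊛-geoFactor c {e@(suc _)} 1≤e n = begin
  (linFactor (- c) e ⊛ G) n
    ≡⟨ ⊛-distribʳ-⊕ oneS (monomial (- c) e) G n ⟩
  (oneS ⊛ G) n +ℤ (monomial (- c) e ⊛ G) n
    ≡⟨ cong (_+ℤ (monomial (- c) e ⊛ G) n) (⊛-identityˡ G n) ⟩
  G n +ℤ (monomial (- c) e ⊛ G) n
    ≡⟨ cancel n ⟩
  oneS n ∎
  where
  open ≡-Reasoning
  G : Series
  G = geoFactor c e
  above : ∀ r → G (e + r) +ℤ (monomial (- c) e ⊛ G) (e + r) ≡ + 0
  above r = begin
    G (e + r) +ℤ (monomial (- c) e ⊛ G) (e + r)
      ≡⟨ cong₂ _+ℤ_ (geoFactor-step c 1≤e r)
                    (monomial-⊛-≥ (- c) e G (e + r) (ℕ.m≤m+n e r)) ⟩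
    c *ℤ G r +ℤ - c *ℤ G (e + r ∸ e)
      ≡⟨ cong (λ i → c *ℤ G r +ℤ - c *ℤ G i) (ℕ.m+n∸m≡n e r) ⟩
    c *ℤ G r +ℤ - c *ℤ G r
      ≡⟨ sym (ℤ.*-distribʳ-+ (G r) c (- c)) ⟩
    (c +ℤ - c) *ℤ G r
      ≡⟨ cong (_*ℤ G r) (ℤ.+-inverseʳ c) ⟩
    + 0 ∎
  cancel : ∀ n → G n +ℤ (monomial (- c) e ⊛ G) n ≡ oneS n
  cancel n with e ≤? n
  ... | no e≰n = trans (cong₂ _+ℤ_ (geoFactor-OneUpTo c (ℕ.≰⇒> e≰n) n ℕ.≤-refl)
                                    (monomial-⊛-< (- c) e G n (ℕ.≰⇒> e≰n)))
                       (ℤ.+-identityʳ _)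
  ... | yes e≤n = subst (λ n → G n +ℤ (monomial (- c) e ⊛ G) n ≡ oneS n)
                        (ℕ.m+[n∸m]≡n e≤n) (above (n ∸ e))

-- The right-hand side

infProd-progression : ∀ (φ : ℕ → Series) → (∀ {k e} → k < e → OneUpTo k (φ e)) →
  ∀ {e m} .{{_ : NonZero m}} → 1 ≤ e →
  infProd (λ k → φ (e + k * m)) ≈ φ e ⊛ infProd (λ k → φ ((e + m) + k * m))
infProd-progression φ φ≈1 {e} {m} 1≤e = begin
  infProd F
    ≈⟨ infProd-uncons F (λ k → φ≈1 (k<e+k*m k)) ⟩
  F 0 ⊛ infProd (λ k → F (suc k))
    ≈⟨ ⊛-cong (φ-cong (ℕ.+-identityʳ e)) (infProd-cong (λ k → φ-cong (sym (ℕ.+-assoc e m (k * m))))) ⟩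
  φ e ⊛ infProd (λ k → φ ((e + m) + k * m)) ∎
  where
  open ≈-Reasoning
  F : ℕ → Series
  F k = φ (e + k * m)
  φ-cong : ∀ {x y} → x ≡ y → φ x ≈ φ y
  φ-cong x≡y n = cong (λ x → φ x n) x≡y
  k<e+k*m : ∀ k → k < e + k * m
  k<e+k*m k = ℕ.<-≤-trans (s≤s (ℕ.m≤m*n k m)) (ℕ.+-monoˡ-≤ (k * m) 1≤e)

qPoch-uncons : ∀ c {e m} .{{_ : NonZero m}} → 1 ≤ e →
  qPoch c e m ≈ linFactor (- c) e ⊛ qPoch c (e + m) m
qPoch-uncons c = infProd-progression (linFactor (- c)) (linFactor-OneUpTo (- c))

linFactor-⊛-qPochInv : ∀ c {e m} .{{_ : NonZero m}} → 1 ≤ e →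
  linFactor (- c) e ⊛ qPochInv c e m ≈ qPochInv c (e + m) m
linFactor-⊛-qPochInv c {e} {m} 1≤e = begin
  L ⊛ qPochInv c e m
    ≈⟨ ⊛-congˡ L (infProd-progression (geoFactor c) (geoFactor-OneUpTo c) 1≤e) ⟩
  L ⊛ (geoFactor c e ⊛ qPochInv c (e + m) m)
    ≈⟨ ≈-sym (⊛-assoc L (geoFactor c e) (qPochInv c (e + m) m)) ⟩
  (L ⊛ geoFactor c e) ⊛ qPochInv c (e + m) m
    ≈⟨ ⊛-congʳ (qPochInv c (e + m) m) (linFactor-⊛-geoFactor c 1≤e) ⟩
  oneS ⊛ qPochInv c (e + m) m
    ≈⟨ ⊛-identityˡ _ ⟩
  qPochInv c (e + m) m ∎
  where
  open ≈-Reasoning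
  L : Series
  L = linFactor (- c) e

monomial-neg : ∀ s d n → monomial (- s) d n ≡ - monomial s d n
monomial-neg s d n with n ≡ᵇ d
... | true  = refl
... | false = refl

linFactor-split : ∀ s t d e →
  linFactor (s *ℤ t) (d + e) ≈ linFactor (- s) d ⊕ monomial s d ⊛ linFactor t e
linFactor-split s t d e n = sym (begin
  (oneS n +ℤ monomial (- s) d n) +ℤ (monomial s d ⊛ (oneS ⊕ monomial t e)) n
    ≡⟨ cong₂ _+ℤ_ (cong (oneS n +ℤ_) (monomial-neg s d n))
         (trans (⊛-distribˡ-⊕ oneS (monomial t e) (monomial s d) n)
                (cong₂ _+ℤ_ (⊛-identityʳ (monomial s d) n) (monomial-⊛-monomial s t d e n))) ⟩
  (oneS n +ℤ - monomial s d n) +ℤ (monomial s d n +ℤ monomial (s *ℤ t) (d + e) n)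
    ≡⟨ cancel (oneS n) (monomial s d n) (monomial (s *ℤ t) (d + e) n) ⟩
  oneS n +ℤ monomial (s *ℤ t) (d + e) n ∎)
  where
  open ≡-Reasoning
  open Data.Integer.Solver.+-*-Solver using (solve; _:+_; :-_; _:=_)
  cancel : ∀ x y z → (x +ℤ - y) +ℤ (y +ℤ z) ≡ x +ℤ z
  cancel = solve 3 (λ x y z → (x :+ :- y) :+ (y :+ z) := x :+ z) refl

linFactor-split-⊛ : ∀ s t d e X →
  linFactor (s *ℤ t) (d + e) ⊛ X ≈ linFactor (- s) d ⊛ X ⊕ monomial s d ⊛ (linFactor t e ⊛ X)
linFactor-split-⊛ s t d e X = begin
  linFactor (s *ℤ t) (d + e) ⊛ X
    ≈⟨ ⊛-congʳ X (linFactor-split s t d e) ⟩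
  (linFactor (- s) d ⊕ monomial s d ⊛ linFactor t e) ⊛ X
    ≈⟨ ⊛-distribʳ-⊕ (linFactor (- s) d) (monomial s d ⊛ linFactor t e) X ⟩
  linFactor (- s) d ⊛ X ⊕ (monomial s d ⊛ linFactor t e) ⊛ X
    ≈⟨ ⊕-cong {linFactor (- s) d ⊛ X} ≈-refl (⊛-assoc (monomial s d) (linFactor t e) X) ⟩
  linFactor (- s) d ⊛ X ⊕ monomial s d ⊛ (linFactor t e ⊛ X) ∎
  where open ≈-Reasoning

rhsSeries-small : ∀ a b m {n} → n < a → n < b → rhsSeries a b m n ≡ oneS n
rhsSeries-small a b m {n} n<a n<b = ⊛-OneUpTo
  (infProd-OneUpTo _ (λ _ → linFactor-OneUpTo (+ 1)
    (below (ℕ.≤-trans (ℕ.m≤m+n a b) (ℕ.m≤m+n _ _)))))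
  (⊛-OneUpTo (infProd-OneUpTo _ (λ _ → geoFactor-OneUpTo (- + 1) (below (ℕ.m≤m+n a _))))
             (infProd-OneUpTo _ (λ _ → geoFactor-OneUpTo (+ 1) (ℕ.<-≤-trans n<b (ℕ.m≤m+n b _)))))
  n ℕ.≤-refl
  where
  below : ∀ {e} → a ≤ e → n < e
  below = ℕ.<-≤-trans n<a

module _ (m : ℕ) .{{_ : NonZero m}} {a b : ℕ} (1≤a : 1 ≤ a) (1≤b : 1 ≤ b) where

  private
    P : ℕ → Series
    P e = qPoch (- + 1) e m

    A : ℕ → Series
    A e = qPochInv (- + 1) e m

    B : ℕ → Series
    B e = qPochInv (+ 1) e m

    P-cong : ∀ {x y} → x ≡ y → P x ≈ P y
    P-cong x≡y n = cong (λ x → P x n) x≡y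

    X : Series
    X = P (a + b + m) ⊛ (A a ⊛ B b)

    rhs≈ : rhsSeries a b m ≈ linFactor (+ 1) (a + b) ⊛ X
    rhs≈ = ≈-trans (⊛-congʳ (A a ⊛ B b) (qPoch-uncons (- + 1) (ℕ.≤-trans 1≤a (ℕ.m≤m+n a b))))
                   (⊛-assoc (linFactor (+ 1) (a + b)) (P (a + b + m)) (A a ⊛ B b))

    rhs-sky+≈ : rhsSeries a (b + m) m ≈ linFactor (- + 1) b ⊛ X
    rhs-sky+≈ = begin
      P (a + (b + m)) ⊛ (A a ⊛ B (b + m))
        ≈⟨ ⊛-cong (P-cong (sym (ℕ.+-assoc a b m)))
                  (⊛-congˡ (A a) (≈-sym (linFactor-⊛-qPochInv (+ 1) 1≤b))) ⟩
      P (a + b + m) ⊛ (A a ⊛ (linFactor (- + 1) b ⊛ B b))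
        ≈⟨ ⊛-congˡ (P (a + b + m)) (⊛-lcomm (A a) (linFactor (- + 1) b) (B b)) ⟩
      P (a + b + m) ⊛ (linFactor (- + 1) b ⊛ (A a ⊛ B b))
        ≈⟨ ⊛-lcomm (P (a + b + m)) (linFactor (- + 1) b) (A a ⊛ B b) ⟩
      linFactor (- + 1) b ⊛ X ∎
      where open ≈-Reasoning

    rhs-ground+≈ : rhsSeries (a + m) b m ≈ linFactor (+ 1) a ⊛ X
    rhs-ground+≈ = begin
      P (a + m + b) ⊛ (A (a + m) ⊛ B b)
        ≈⟨ ⊛-cong (P-cong (xy∙z≈xz∙y a m b))
                  (⊛-congʳ (B b) (≈-sym (linFactor-⊛-qPochInv (- + 1) 1≤a))) ⟩
      P (a + b + m) ⊛ ((linFactor (+ 1) a ⊛ A a) ⊛ B b)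
        ≈⟨ ⊛-congˡ (P (a + b + m)) (⊛-assoc (linFactor (+ 1) a) (A a) (B b)) ⟩
      P (a + b + m) ⊛ (linFactor (+ 1) a ⊛ (A a ⊛ B b))
        ≈⟨ ⊛-lcomm (P (a + b + m)) (linFactor (+ 1) a) (A a ⊛ B b) ⟩
      linFactor (+ 1) a ⊛ X ∎
      where open ≈-Reasoning

  rhsSeries-ground-recurrence :
    rhsSeries a b m ≈ rhsSeries (a + m) b m ⊕ monomial (- + 1) a ⊛ rhsSeries a (b + m) m
  rhsSeries-ground-recurrence = begin
    rhsSeries a b m
      ≈⟨ rhs≈ ⟩
    linFactor (- + 1 *ℤ - + 1) (a + b) ⊛ X
      ≈⟨ linFactor-split-⊛ (- + 1) (- + 1) a b X ⟩
    linFactor (+ 1) a ⊛ X ⊕ monomial (- + 1) a ⊛ (linFactor (- + 1) b ⊛ X)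
      ≈⟨ ⊕-cong (≈-sym rhs-ground+≈) (⊛-congˡ (monomial (- + 1) a) (≈-sym rhs-sky+≈)) ⟩
    rhsSeries (a + m) b m ⊕ monomial (- + 1) a ⊛ rhsSeries a (b + m) m ∎
    where open ≈-Reasoning

  rhsSeries-sky-recurrence :
    rhsSeries a b m ≈ rhsSeries a (b + m) m ⊕ monomial (+ 1) b ⊛ rhsSeries (a + m) b m
  rhsSeries-sky-recurrence = begin
    rhsSeries a b m
      ≈⟨ rhs≈ ⟩
    linFactor (+ 1) (a + b) ⊛ X
      ≈⟨ ⊛-congʳ X (λ n → cong (λ e → linFactor (+ 1) e n) (ℕ.+-comm a b)) ⟩
    linFactor (+ 1 *ℤ + 1) (b + a) ⊛ X
      ≈⟨ linFactor-split-⊛ (+ 1) (+ 1) b a X ⟩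
    linFactor (- + 1) b ⊛ X ⊕ monomial (+ 1) b ⊛ (linFactor (+ 1) a ⊛ X)
      ≈⟨ ⊕-cong (≈-sym rhs-sky+≈) (⊛-congˡ (monomial (+ 1) b) (≈-sym rhs-ground+≈)) ⟩
    rhsSeries a (b + m) m ⊕ monomial (+ 1) b ⊛ rhsSeries (a + m) b m ∎
    where open ≈-Reasoning

  rhsSeries-ground-step : ∀ {n} → a ≤ n →
    rhsSeries a b m n ≡ rhsSeries (a + m) b m n - rhsSeries a (b + m) m (n ∸ a)
  rhsSeries-ground-step {n} a≤n = trans (rhsSeries-ground-recurrence n)
    (cong (rhsSeries (a + m) b m n +ℤ_)
      (trans (monomial-⊛-≥ (- + 1) a (rhsSeries a (b + m) m) n a≤n) (ℤ.-1*i≡-i _)))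

  rhsSeries-sky-step : ∀ {n} → b ≤ n →
    rhsSeries a b m n ≡ rhsSeries a (b + m) m n +ℤ rhsSeries (a + m) b m (n ∸ b)
  rhsSeries-sky-step {n} b≤n = trans (rhsSeries-sky-recurrence n)
    (cong (rhsSeries a (b + m) m n +ℤ_)
      (trans (monomial-⊛-≥ (+ 1) b (rhsSeries (a + m) b m) n b≤n) (ℤ.*-identityˡ _)))

-- Signed counts

SignedCount : Set → Set → ℤ → Set
SignedCount X Y z = ∃₂ λ (k l : ℕ) → (Fin k ↔ X) × (Fin l ↔ Y) × ((+ k) - (+ l) ≡ z)

Fin0↔ : ∀ {Z : Set} → ¬ Z → Fin 0 ↔ Z
Fin0↔ ¬Z = mk↔ₛ′ (λ ()) (⊥-elim ∘ ¬Z) (⊥-elim ∘ ¬Z) (λ ())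

Fin1↔ : ∀ {Z : Set} (z : Z) → (∀ z′ → z′ ≡ z) → Fin 1 ↔ Z
Fin1↔ z unique = mk↔ₛ′ (λ _ → z) (λ _ → Fin.zero) (sym ∘ unique) (λ { Fin.zero → refl ; (Fin.suc ()) })

module _ {X Y : Set} where

  SignedCount-↔ : ∀ {X′ Y′ z} → X ↔ X′ → Y ↔ Y′ → SignedCount X Y z → SignedCount X′ Y′ z
  SignedCount-↔ X↔X′ Y↔Y′ (k , l , k↔X , l↔Y , k-l≡z) =
    k , l , ↔-trans k↔X X↔X′ , ↔-trans l↔Y Y↔Y′ , k-l≡z

  SignedCount-⊎ : ∀ {X′ Y′ z z′} → SignedCount X Y z → SignedCount X′ Y′ z′ →
    SignedCount (X ⊎ X′) (Y ⊎ Y′) (z +ℤ z′)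
  SignedCount-⊎ (k , l , k↔X , l↔Y , refl) (k′ , l′ , k′↔X′ , l′↔Y′ , refl) =
    k + k′ , l + l′ ,
    ↔-trans Fin.+↔⊎ (k↔X ⊎-↔ k′↔X′) , ↔-trans Fin.+↔⊎ (l↔Y ⊎-↔ l′↔Y′) ,
    trans (cong₂ _-_ (ℤ.pos-+ k k′) (ℤ.pos-+ l l′))
      (solve 4 (λ k k′ l l′ → (k :+ k′) :- (l :+ l′) := (k :- l) :+ (k′ :- l′)) refl
        (+ k) (+ k′) (+ l) (+ l′))
    where open Data.Integer.Solver.+-*-Solver using (solve; _:+_; _:-_; _:=_)

  SignedCount-swap : ∀ {z} → SignedCount X Y z → SignedCount Y X (- z)
  SignedCount-swap (k , l , k↔X , l↔Y , refl) =
    l , k , l↔Y , k↔X , solve 2 (λ k l → l :- k := :- (k :- l)) refl (+ k) (+ l)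
    where open Data.Integer.Solver.+-*-Solver using (solve; _:-_; :-_; _:=_)

  SignedCount-empty : ¬ X → ¬ Y → SignedCount X Y (+ 0)
  SignedCount-empty ¬X ¬Y = 0 , 0 , Fin0↔ ¬X , Fin0↔ ¬Y , refl

  SignedCount-singleton : (x : X) → (∀ x′ → x′ ≡ x) → ¬ Y → SignedCount X Y (+ 1)
  SignedCount-singleton x unique ¬Y = 1 , 0 , Fin1↔ x unique , Fin0↔ ¬Y , refl

-- Copartitions

upward-induction : ∀ s n .{{_ : NonZero s}} (P : ℕ → Set) →
  (∀ a → n < a → P a) → (∀ a → a ≤ n → P (a + s) → P a) → ∀ a → P a
upward-induction s n P base step a = go (suc n) a (ℕ.m≤n+m (suc n) a)
  where
  go : ∀ t a → n < a + t → P a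
  go zero    a n<a+0 = base a (subst (n <_) (ℕ.+-identityʳ a) n<a+0)
  go (suc t) a n<a+t with a ≤? n
  ... | no  a≰n = base a (ℕ.≰⇒> a≰n)
  ... | yes a≤n = step a a≤n (go t (a + s) (ℕ.<-≤-trans n<a+t a+1+t≤a+s+t))
    where
    a+1+t≤a+s+t : a + suc t ≤ a + s + t
    a+1+t≤a+s+t = subst (a + suc t ≤_) (sym (ℕ.+-assoc a s t))
      (ℕ.+-monoʳ-≤ a (ℕ.+-monoˡ-≤ t (>-nonZero⁻¹ s)))

GroundParity : ℕ → ℕ → ℕ → Set
GroundParity p i _ = i % 2 ≡ p

GroundParity-irrelevant : ∀ p i j → Irrelevant (GroundParity p i j)
GroundParity-irrelevant p i j = ℕ.≡-irrelevant

%2-suc : ∀ i → suc i % 2 ≡ 1 ∸ i % 2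
%2-suc zero          = refl
%2-suc (suc zero)    = refl
%2-suc (suc (suc i)) = %2-suc i

%2≤1 : ∀ i → i % 2 ≤ 1
%2≤1 i = ℕ.≤-pred (m%n<n i 2)


linked-∷ʳ⁺ : ∀ {A : Set} {R : A → A → Set} {r} xs →
  Linked R xs → All (λ x → R x r) xs → Linked R (xs ∷ʳ r)
linked-∷ʳ⁺ []           _          _          = [-]
linked-∷ʳ⁺ (x ∷ [])     _          (Rxr ∷ []) = Rxr ∷ [-]
linked-∷ʳ⁺ (x ∷ y ∷ xs) (Rxy ∷ l) (_ ∷ Rr)   = Rxy ∷ linked-∷ʳ⁺ (y ∷ xs) l Rr

linked-∷ʳ⁻ : ∀ {A : Set} {R : A → A → Set} {r} xs → Linked R (xs ∷ʳ r) → Linked R xs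
linked-∷ʳ⁻ []           _         = []
linked-∷ʳ⁻ (x ∷ [])     _         = [-]
linked-∷ʳ⁻ (x ∷ y ∷ xs) (Rxy ∷ l) = Rxy ∷ linked-∷ʳ⁻ (y ∷ xs) l

length-∷ʳ : ∀ {A : Set} (xs : List A) r → length (xs ∷ʳ r) ≡ suc (length xs)
length-∷ʳ xs r = trans (LP.length-++ xs) (ℕ.+-comm (length xs) 1)

sum-replicate : ∀ k v → sum (replicate k v) ≡ k * v
sum-replicate zero    v = refl
sum-replicate (suc k) v = cong (λ s → v + s) (sum-replicate k v)

module Copartitions (m : ℕ) .{{_ : NonZero m}} where

  congAtLeast : ∀ r k → CongAtLeast r m (r + k * m)
  congAtLeast r k = ℕ.m≤m+n r (k * m) , divides k (ℕ.m+n∸m≡n r (k * m))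

  congAtLeast⁻¹ : ∀ {r x} → CongAtLeast r m x → ∃[ k ] x ≡ r + k * m
  congAtLeast⁻¹ {r} (r≤x , divides k x∸r≡km) =
    k , trans (sym (ℕ.m+[n∸m]≡n r≤x)) (cong (λ y → r + y) x∸r≡km)

  congAtLeast-≡ : ∀ {r x} k → x ≡ r + k * m → CongAtLeast r m x
  congAtLeast-≡ {r} k refl = congAtLeast r k

  congAtLeast-irrelevant : ∀ {r x} → Irrelevant (CongAtLeast r m x)
  congAtLeast-irrelevant (r≤x , divides k eq) (r≤x′ , divides k′ eq′)
    with ℕ.*-cancelʳ-≡ k k′ m (trans (sym eq) eq′)
  ... | refl =
    cong₂ (λ p q → p , divides k q) (ℕ.≤-irrelevant r≤x r≤x′) (ℕ.≡-irrelevant eq eq′)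

  congAtLeast-lower : ∀ {r x} → CongAtLeast (r + m) m x → CongAtLeast r m x
  congAtLeast-lower {r} c with congAtLeast⁻¹ c
  ... | k , refl = congAtLeast-≡ (suc k) (ℕ.+-assoc r m (k * m))

  congAtLeast-raise : ∀ {r x} → CongAtLeast r m x → r + m ≤ x → CongAtLeast (r + m) m x
  congAtLeast-raise {r} c r+m≤x with congAtLeast⁻¹ c
  ... | zero  , refl = ⊥-elim (ℕ.≤⇒≯ (ℕ.+-cancelˡ-≤ r m 0 r+m≤x) (>-nonZero⁻¹ m))
  ... | suc k , refl = congAtLeast-≡ k (sym (ℕ.+-assoc r m (k * m)))

  congAtLeast-< : ∀ {r x} → CongAtLeast r m x → x < r + m → x ≡ r
  congAtLeast-< {r} c x<r+m with congAtLeast⁻¹ c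
  ... | zero  , refl = ℕ.+-identityʳ r
  ... | suc k , refl = ⊥-elim (ℕ.<⇒≱ x<r+m (ℕ.+-monoʳ-≤ r (ℕ.m≤m+n m (k * m))))

  congAtLeast-+ : ∀ {r x} → CongAtLeast r m x → CongAtLeast (r + m) m (x + m)
  congAtLeast-+ {r} c with congAtLeast⁻¹ c
  ... | k , refl = congAtLeast-≡ k (xy∙z≈xz∙y r (k * m) m)

  congAtLeast-∸ : ∀ {r x} → CongAtLeast (r + m) m x → CongAtLeast r m (x ∸ m)
  congAtLeast-∸ {r} c with congAtLeast⁻¹ c
  ... | k , refl = congAtLeast-≡ k (trans (cong (_∸ m) (xy∙z≈xz∙y r m (k * m))) (ℕ.m+n∸n≡m _ m))

  Side : ℕ → List ℕ → Set
  Side r xs = IsPartition xs × All (CongAtLeast r m) xs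

  side : ∀ {r xs} → 1 ≤ r → Linked _≥_ xs → All (CongAtLeast r m) xs → Side r xs
  side 1≤r l cs = (l , All.map (λ c → ℕ.≤-trans 1≤r (proj₁ c)) cs) , cs

  Side-irrelevant : ∀ {r} → U.Irrelevant (Side r)
  Side-irrelevant ((l , ps) , cs) ((l′ , ps′) , cs′) = cong₂ _,_
    (cong₂ _,_ (Linked.irrelevant ℕ.≤-irrelevant l l′) (All.irrelevant ℕ.≤-irrelevant ps ps′))
    (All.irrelevant congAtLeast-irrelevant cs cs′)

  Side-lower : ∀ {r xs} → Side (r + m) xs → Side r xs
  Side-lower (p , cs) = p , All.map congAtLeast-lower cs

  Side-+ : ∀ {r xs} → Side r xs → Side (r + m) (map (_+ m) xs)
  Side-+ {r} ((l , _) , cs) = side (ℕ.≤-trans (>-nonZero⁻¹ m) (ℕ.m≤n+m m r))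
    (Linked.map⁺ (Linked.map (ℕ.+-monoˡ-≤ m) l)) (All.map⁺ (All.map congAtLeast-+ cs))

  Side-∸ : ∀ {r xs} → 1 ≤ r → Side (r + m) xs → Side r (map (_∸ m) xs)
  Side-∸ 1≤r ((l , _) , cs) = side 1≤r
    (Linked.map⁺ (Linked.map (ℕ.∸-monoˡ-≤ m) l)) (All.map⁺ (All.map congAtLeast-∸ cs))

  ∸-+-inverse : ∀ xs → map (_∸ m) (map (_+ m) xs) ≡ xs
  ∸-+-inverse xs =
    trans (sym (LP.map-∘ xs)) (LP.map-id-local (All.universal (λ x → ℕ.m+n∸n≡m x m) xs))

  +-∸-inverse : ∀ {r xs} → Side (r + m) xs → map (_+ m) (map (_∸ m) xs) ≡ xs
  +-∸-inverse {r} (_ , cs) = trans (sym (LP.map-∘ _))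
    (LP.map-id-local (All.map (λ c → ℕ.m∸n+n≡m (ℕ.≤-trans (ℕ.m≤n+m m r) (proj₁ c))) cs))

  Side-∷ʳ⁺ : ∀ {r} ys → 1 ≤ r → Side r ys → Side r (ys ∷ʳ r)
  Side-∷ʳ⁺ {r} ys 1≤r ((l , _) , cs) = side 1≤r
    (linked-∷ʳ⁺ ys l (All.map proj₁ cs)) (All.∷ʳ⁺ cs (congAtLeast-≡ 0 (sym (ℕ.+-identityʳ r))))

  Side-∷ʳ⁻ : ∀ {r} ys → Side r (ys ∷ʳ r) → Side r ys
  Side-∷ʳ⁻ ys ((l , ps) , cs) =
    (linked-∷ʳ⁻ ys l , proj₁ (All.∷ʳ⁻ ps)) , proj₁ (All.∷ʳ⁻ cs)

  ¬Side-∷ʳ : ∀ {r} ys → ¬ Side (r + m) (ys ∷ʳ r)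
  ¬Side-∷ʳ {r} ys (_ , cs) =
    ℕ.<⇒≱ (ℕ.m<m+n r (>-nonZero⁻¹ m)) (proj₁ (proj₂ (All.∷ʳ⁻ cs)))

  split-lowest : ∀ {r} xs → Linked _≥_ xs → All (CongAtLeast r m) xs →
    All (r + m ≤_) xs ⊎ ∃[ ys ] xs ≡ ys ∷ʳ r
  split-lowest [] _ _ = inj₁ []
  split-lowest {r} (x ∷ xs) l (c ∷ cs) with split-lowest xs (Linked.tail l) cs
  ... | inj₂ (ys , refl) = inj₂ (x ∷ ys , refl)
  ... | inj₁ big with r + m ≤? x
  ...   | yes r+m≤x = inj₁ (r+m≤x ∷ big)
  ...   | no  r+m≰x =
    inj₂ ([] , cong₂ _∷_ (congAtLeast-< c (ℕ.≰⇒> r+m≰x)) (nothing-below xs l big))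
    where
    nothing-below : ∀ xs → Linked _≥_ (x ∷ xs) → All (r + m ≤_) xs → xs ≡ []
    nothing-below []      _         _           = refl
    nothing-below (y ∷ _) (x≥y ∷ _) (r+m≤y ∷ _) = ⊥-elim (r+m≰x (ℕ.≤-trans r+m≤y x≥y))

  Side-split : ∀ {r xs} → Side r xs → Side (r + m) xs ⊎ ∃[ ys ] xs ≡ ys ∷ʳ r
  Side-split {r} {xs} (p@(l , _) , cs) with split-lowest xs l cs
  ... | inj₁ big = inj₁ (p , All.zipWith (λ (c , r+m≤x) → congAtLeast-raise c r+m≤x) (cs , big))
  ... | inj₂ eq  = inj₂ eq

  -- ρ is not stored: it adds m ν(γ) ν(σ) to the size. Q constrains the part counts (ν(γ), ν(σ)).
  weight : List ℕ → List ℕ → ℕ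
  weight γ σ = sum γ + sum σ + m * (length γ * length σ)

  Copartitions : ℕ → ℕ → ℕ → (ℕ → ℕ → Set) → Set
  Copartitions a b n Q = Σ[ γ ∈ List ℕ ] Σ[ σ ∈ List ℕ ]
    Side a γ × Side b σ × weight γ σ ≡ n × Q (length γ) (length σ)

  Copartitions-≡ : ∀ {a b n Q} → (∀ i j → Irrelevant (Q i j)) → {x y : Copartitions a b n Q} →
    proj₁ x ≡ proj₁ y → proj₁ (proj₂ x) ≡ proj₁ (proj₂ y) → x ≡ y
  Copartitions-≡ Q-irr {_ , _ , sγ , sσ , w , q} {_ , _ , sγ′ , sσ′ , w′ , q′} refl refl
    rewrite Side-irrelevant sγ sγ′ | Side-irrelevant sσ sσ′ | ℕ.≡-irrelevant w w′ | Q-irr _ _ q q′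
    = refl

  open Data.Nat.Solver.+-*-Solver using (solve; _:+_; _:*_; _:=_; con)

  size≡weight : ∀ {a b} (c : Copartition a b m) → size c ≡ weight (ground c) (sky c)
  size≡weight record { ground = γ ; sky = σ ; rhoDef = refl } =
    trans (cong (λ r → sum γ + r + sum σ) (sum-replicate (length σ) (m * length γ)))
      (solve 5 (λ g s m k l → g :+ l :* (m :* k) :+ s := g :+ s :+ m :* (k :* l)) refl
        (sum γ) (sum σ) m (length γ) (length σ))

  CP : ℕ → ℕ → ℕ → (ℕ → ℕ → Set) → Set
  CP a b n Q = Σ (Copartition a b m) λ c → size c ≡ n × Q (length (ground c)) (length (sky c))

  CP↔Copartitions : ∀ {a b n Q} → (∀ i j → Irrelevant (Q i j)) → CP a b n Q ↔ Copartitions a b n Q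
  CP↔Copartitions {a} {b} {n} {Q} Q-irr =
    mk↔ₛ′ to from (λ _ → Copartitions-≡ {a} {b} {n} {Q} Q-irr refl refl) from-to
    where
    to : CP a b n Q → Copartitions a b n Q
    to (c , size≡n , q) = ground c , sky c , (groundPart c , groundCong c) , (skyPart c , skyCong c) ,
      trans (sym (size≡weight c)) size≡n , q
    from : Copartitions a b n Q → CP a b n Q
    from (γ , σ , (gp , gc) , (sp , sc) , w , q) = c , trans (size≡weight c) w , q
      where
      c : Copartition a b m
      c = record { ground = γ ; rho = replicate (length σ) (m * length γ) ; sky = σ
                 ; groundPart = gp ; groundCong = gc ; skyPart = sp ; skyCong = sc ; rhoDef = refl }
    from-to : ∀ x → from (to x) ≡ x
    from-to (c@record { rhoDef = refl } , size≡n , q) = cong (λ e → c , e , q) (ℕ.≡-irrelevant _ _)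

  weight-comm : ∀ γ σ → weight γ σ ≡ weight σ γ
  weight-comm γ σ = solve 5 (λ g s m k l → g :+ s :+ m :* (k :* l) := s :+ g :+ m :* (l :* k)) refl
    (sum γ) (sum σ) m (length γ) (length σ)

  Copartitions-swap : ∀ {a b n Q} → (∀ i j → Irrelevant (Q i j)) →
    Copartitions a b n Q ↔ Copartitions b a n (flip Q)
  Copartitions-swap {a} {b} {n} {Q} Q-irr = mk↔ₛ′ (swap {a} {b} {n} {Q}) (swap {b} {a} {n} {flip Q})
    (λ _ → Copartitions-≡ {b} {a} {n} {flip Q} (flip Q-irr) refl refl)
    (λ _ → Copartitions-≡ {a} {b} {n} {Q} Q-irr refl refl)
    where
    swap : ∀ {a b n Q} → Copartitions a b n Q → Copartitions b a n (flip Q)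
    swap (γ , σ , sγ , sσ , w , q) = σ , γ , sσ , sγ , trans (weight-comm σ γ) w , q

  sum-map-+ : ∀ xs → sum (map (_+ m) xs) ≡ sum xs + length xs * m
  sum-map-+ []       = refl
  sum-map-+ (x ∷ xs) = trans (cong (λ s → x + m + s) (sum-map-+ xs))
    (solve 4 (λ x m s l → x :+ m :+ (s :+ l :* m) := x :+ s :+ (m :+ l :* m)) refl
      x m (sum xs) (length xs))

  weight-∷ʳ : ∀ ys r σ → weight (ys ∷ʳ r) σ ≡ r + weight ys (map (_+ m) σ)
  weight-∷ʳ ys r σ = begin
    sum (ys ∷ʳ r) + sum σ + m * (length (ys ∷ʳ r) * length σ)
      ≡⟨ cong₂ (λ s l → s + sum σ + m * (l * length σ)) (sum-++ ys (r ∷ [])) (length-∷ʳ ys r) ⟩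
    sum ys + (r + 0) + sum σ + m * (suc (length ys) * length σ)
      ≡⟨ solve 6 (λ y r s m k l → y :+ (r :+ con 0) :+ s :+ m :* ((con 1 :+ k) :* l)
                              := r :+ (y :+ (s :+ l :* m) :+ m :* (k :* l)))
           refl (sum ys) r (sum σ) m (length ys) (length σ) ⟩
    r + (sum ys + (sum σ + length σ * m) + m * (length ys * length σ))
      ≡⟨ cong₂ (λ s l → r + (sum ys + s + m * (length ys * l)))
           (sym (sum-map-+ σ)) (sym (LP.length-map (_+ m) σ)) ⟩
    r + weight ys (map (_+ m) σ) ∎
    where open ≡-Reasoning

  module _ {Q : ℕ → ℕ → Set} (Q-irr : ∀ i j → Irrelevant (Q i j))
           {a b n : ℕ} (1≤a : 1 ≤ a) (1≤b : 1 ≤ b) (a≤n : a ≤ n) where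

    private
      Target : Set
      Target = Copartitions (a + m) b n Q ⊎ Copartitions a (b + m) (n ∸ a) (λ i → Q (suc i))

      to-with : (x : Copartitions a b n Q) → Side (a + m) (proj₁ x) ⊎ ∃[ ys ] proj₁ x ≡ ys ∷ʳ a → Target
      to-with (γ , σ , _ , sσ , w , q) (inj₁ sγ) = inj₁ (γ , σ , sγ , sσ , w , q)
      to-with (_ , σ , sγ , sσ , w , q) (inj₂ (ys , refl)) = inj₂
        (ys , map (_+ m) σ , Side-∷ʳ⁻ ys sγ , Side-+ sσ ,
         trans (sym (ℕ.m+n∸m≡n a _)) (cong (_∸ a) (trans (sym (weight-∷ʳ ys a σ)) w)) ,
         subst₂ Q (length-∷ʳ ys a) (sym (LP.length-map (_+ m) σ)) q)

      to : Copartitions a b n Q → Target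
      to x@(_ , _ , sγ , _) = to-with x (Side-split sγ)

      from : Target → Copartitions a b n Q
      from (inj₁ (γ , σ , sγ , sσ , w , q)) = γ , σ , Side-lower sγ , sσ , w , q
      from (inj₂ (ys , τ , sys , sτ , w , q)) =
        ys ∷ʳ a , map (_∸ m) τ , Side-∷ʳ⁺ ys 1≤a sys , Side-∸ 1≤b sτ ,
        trans (weight-∷ʳ ys a (map (_∸ m) τ))
          (trans (cong (λ τ′ → a + weight ys τ′) (+-∸-inverse sτ))
            (trans (cong (λ k → a + k) w) (ℕ.m+[n∸m]≡n a≤n))) ,
        subst₂ Q (sym (length-∷ʳ ys a)) (sym (LP.length-map (_∸ m) τ)) q

      from-to-with : ∀ x s → from (to-with x s) ≡ x
      from-to-with _           (inj₁ _)          = Copartitions-≡ {Q = Q} Q-irr refl refl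
      from-to-with (_ , σ , _) (inj₂ (_ , refl)) = Copartitions-≡ {Q = Q} Q-irr refl (∸-+-inverse σ)

      to-with-from : ∀ y s → to-with (from y) s ≡ y
      to-with-from (inj₁ _) (inj₁ _) =
        cong inj₁ (Copartitions-≡ {Q = Q} Q-irr refl refl)
      to-with-from (inj₁ (_ , _ , sγ , _)) (inj₂ (ys , eq)) =
        ⊥-elim (¬Side-∷ʳ ys (subst (Side (a + m)) eq sγ))
      to-with-from (inj₂ (ys , _)) (inj₁ sγ) =
        ⊥-elim (¬Side-∷ʳ ys sγ)
      to-with-from (inj₂ (ys , τ , _ , sτ , _)) (inj₂ (zs , eq)) with LP.∷ʳ-injectiveˡ ys zs eq
      ... | refl with eq
      ... | refl = cong inj₂ (Copartitions-≡ {Q = λ i → Q (suc i)} (Q-irr ∘ suc) refl (+-∸-inverse sτ))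

    Copartitions-peel-ground : Copartitions a b n Q ↔
      (Copartitions (a + m) b n Q ⊎ Copartitions a (b + m) (n ∸ a) (λ i → Q (suc i)))
    Copartitions-peel-ground = mk↔ₛ′ to from (λ y → to-with-from y _) (λ x → from-to-with x _)

  Copartitions-peel-sky : ∀ {Q a b n} → (∀ i j → Irrelevant (Q i j)) → 1 ≤ a → 1 ≤ b → b ≤ n →
    Copartitions a b n Q ↔
      (Copartitions a (b + m) n Q ⊎ Copartitions (a + m) b (n ∸ b) (λ i j → Q i (suc j)))
  Copartitions-peel-sky {Q} {a} {b} {n} Q-irr 1≤a 1≤b b≤n =
    ↔-trans (Copartitions-swap {a} {b} {n} {Q} Q-irr)
   (↔-trans (Copartitions-peel-ground {flip Q} (flip Q-irr) {b} {a} {n} 1≤b 1≤a b≤n)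
            (Copartitions-swap {b + m} {a} {n} {flip Q} (flip Q-irr) ⊎-↔
             Copartitions-swap {b} {a + m} {n ∸ b} {λ i → flip Q (suc i)} (flip Q-irr ∘ suc)))

  Copartitions-cong : ∀ {a b n Q Q′} → (∀ i j → Irrelevant (Q i j)) → (∀ i j → Irrelevant (Q′ i j)) →
    (∀ i j → Q i j → Q′ i j) → (∀ i j → Q′ i j → Q i j) →
    Copartitions a b n Q ↔ Copartitions a b n Q′
  Copartitions-cong {Q = Q} {Q′} Q-irr Q′-irr Q⇒Q′ Q′⇒Q = mk↔ₛ′
    (λ (γ , σ , sγ , sσ , w , q) → γ , σ , sγ , sσ , w , Q⇒Q′ _ _ q)
    (λ (γ , σ , sγ , sσ , w , q) → γ , σ , sγ , sσ , w , Q′⇒Q _ _ q)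
    (λ _ → Copartitions-≡ {Q = Q′} Q′-irr refl refl)
    (λ _ → Copartitions-≡ {Q = Q} Q-irr refl refl)

  Copartitions-parity-suc : ∀ {a b n} p → p ≤ 1 →
    Copartitions a b n (λ i → GroundParity p (suc i)) ↔ Copartitions a b n (GroundParity (1 ∸ p))
  Copartitions-parity-suc p p≤1 = Copartitions-cong {Q = λ i → GroundParity p (suc i)}
    (GroundParity-irrelevant p ∘ suc) (GroundParity-irrelevant (1 ∸ p)) (λ i _ → flip-parity i) (λ i _ → unflip-parity i)
    where
    flip-parity : ∀ i → suc i % 2 ≡ p → i % 2 ≡ 1 ∸ p
    flip-parity i i+1%2≡p =
      trans (sym (ℕ.m∸[m∸n]≡n (%2≤1 i))) (cong (1 ∸_) (trans (sym (%2-suc i)) i+1%2≡p))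
    unflip-parity : ∀ i → i % 2 ≡ 1 ∸ p → suc i % 2 ≡ p
    unflip-parity i i%2≡1∸p = trans (%2-suc i) (trans (cong (1 ∸_) i%2≡1∸p) (ℕ.m∸[m∸n]≡n p≤1))

  Side-empty : ∀ {r xs n} → n < r → Side r xs → sum xs ≤ n → xs ≡ []
  Side-empty                 _   (_ , [])            _     = refl
  Side-empty {xs = x ∷ xs} n<r (_ , (r≤x , _) ∷ _) Σxs≤n =
    ⊥-elim (ℕ.<⇒≱ n<r (ℕ.≤-trans r≤x (ℕ.≤-trans (ℕ.m≤m+n x (sum xs)) Σxs≤n)))

  Copartitions-small⇒[] : ∀ {a b n Q} → n < a → n < b → (x : Copartitions a b n Q) →
    proj₁ x ≡ [] × proj₁ (proj₂ x) ≡ []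
  Copartitions-small⇒[] n<a n<b (γ , σ , sγ , sσ , refl , _) =
    Side-empty n<a sγ (ℕ.≤-trans (ℕ.m≤m+n (sum γ) (sum σ)) (ℕ.m≤m+n _ _)) ,
    Side-empty n<b sσ (ℕ.≤-trans (ℕ.m≤n+m (sum σ) (sum γ)) (ℕ.m≤m+n _ _))

  Copartitions-small⇒n≡0 : ∀ {a b n Q} → n < a → n < b → Copartitions a b n Q → n ≡ 0 × Q 0 0
  Copartitions-small⇒n≡0 {Q = Q} n<a n<b x@(_ , _ , _ , _ , w , q)
    with Copartitions-small⇒[] {Q = Q} n<a n<b x
  ... | refl , refl = trans (sym w) (ℕ.*-zeroʳ m) , q

  Even Odd : ℕ → ℕ → ℕ → Set
  Even a b n = Copartitions a b n (GroundParity 0)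
  Odd  a b n = Copartitions a b n (GroundParity 1)

  SignedCopartitionCount : ℕ → ℕ → ℕ → Set
  SignedCopartitionCount a b n = SignedCount (Even a b n) (Odd a b n) (rhsSeries a b m n)

  signedCount-small : ∀ {a b n} → n < a → n < b → SignedCopartitionCount a b n
  signedCount-small {a} {b} {zero} 0<a 0<b =
    subst (SignedCount _ _) (sym (rhsSeries-small a b m 0<a 0<b))
      (SignedCount-singleton empty
        (λ x → uncurry (Copartitions-≡ {Q = GroundParity 0} (GroundParity-irrelevant 0))
                       (Copartitions-small⇒[] {Q = GroundParity 0} 0<a 0<b x))
        (λ x → ℕ.0≢1+n (proj₂ (Copartitions-small⇒n≡0 {Q = GroundParity 1} 0<a 0<b x))))
    where
    empty : Even a b 0
    empty = [] , [] , side 0<a [] [] , side 0<b [] [] , ℕ.*-zeroʳ m , refl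
  signedCount-small {a} {b} {suc n} n<a n<b =
    subst (SignedCount _ _) (sym (rhsSeries-small a b m n<a n<b))
      (SignedCount-empty (λ x → ℕ.1+n≢0 (proj₁ (Copartitions-small⇒n≡0 {Q = GroundParity 0} n<a n<b x)))
                         (λ x → ℕ.1+n≢0 (proj₁ (Copartitions-small⇒n≡0 {Q = GroundParity 1} n<a n<b x))))

  signedCount-ground-step : ∀ {a b n} → 1 ≤ a → 1 ≤ b → a ≤ n →
    SignedCopartitionCount (a + m) b n → SignedCopartitionCount a (b + m) (n ∸ a) →
    SignedCopartitionCount a b n
  signedCount-ground-step {a} {b} {n} 1≤a 1≤b a≤n count₊ count₋ =
    subst (SignedCount _ _) (sym (rhsSeries-ground-step m 1≤a 1≤b a≤n))
      (SignedCount-↔ (↔-sym (peel 0 z≤n)) (↔-sym (peel 1 ℕ.≤-refl))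
        (SignedCount-⊎ count₊ (SignedCount-swap count₋)))
    where
    peel : ∀ p → p ≤ 1 → Copartitions a b n (GroundParity p) ↔
      (Copartitions (a + m) b n (GroundParity p) ⊎ Copartitions a (b + m) (n ∸ a) (GroundParity (1 ∸ p)))
    peel p p≤1 = ↔-trans (Copartitions-peel-ground (GroundParity-irrelevant p) 1≤a 1≤b a≤n)
                         (↔-refl ⊎-↔ Copartitions-parity-suc p p≤1)

  signedCount-sky-step : ∀ {a b n} → 1 ≤ a → 1 ≤ b → b ≤ n →
    SignedCopartitionCount a (b + m) n → SignedCopartitionCount (a + m) b (n ∸ b) →
    SignedCopartitionCount a b n
  signedCount-sky-step {a} {b} {n} 1≤a 1≤b b≤n count₊ count₋ =
    subst (SignedCount _ _) (sym (rhsSeries-sky-step m 1≤a 1≤b b≤n))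
      (SignedCount-↔ (↔-sym (peel 0)) (↔-sym (peel 1)) (SignedCount-⊎ count₊ count₋))
    where
    peel : ∀ p → Copartitions a b n (GroundParity p) ↔
      (Copartitions a (b + m) n (GroundParity p) ⊎ Copartitions (a + m) b (n ∸ b) (GroundParity p))
    peel p = Copartitions-peel-sky (GroundParity-irrelevant p) 1≤a 1≤b b≤n

  signedCount : ∀ n a b → 1 ≤ a → 1 ≤ b → SignedCopartitionCount a b n
  signedCount = <-rec (λ n → ∀ a b → 1 ≤ a → 1 ≤ b → SignedCopartitionCount a b n) counts
    where
    1≤+m : ∀ {x} → 1 ≤ x → 1 ≤ x + m
    1≤+m {x} 1≤x = ℕ.≤-trans 1≤x (ℕ.m≤m+n x m)

    counts : ∀ n → (∀ {n′} → n′ < n → ∀ a b → 1 ≤ a → 1 ≤ b → SignedCopartitionCount a b n′) →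
      ∀ a b → 1 ≤ a → 1 ≤ b → SignedCopartitionCount a b n
    counts n smaller = upward-induction m n _ large-ground ground-step
      where
      large-ground : ∀ a → n < a → ∀ b → 1 ≤ a → 1 ≤ b → SignedCopartitionCount a b n
      large-ground a n<a = upward-induction m n _
        (λ b n<b _ _ → signedCount-small n<a n<b)
        (λ b b≤n larger 1≤a 1≤b → signedCount-sky-step 1≤a 1≤b b≤n (larger 1≤a (1≤+m 1≤b))
           (smaller (ℕ.∸-monoʳ-< 1≤b b≤n) (a + m) b (1≤+m 1≤a) 1≤b))

      ground-step : ∀ a → a ≤ n → (∀ b → 1 ≤ a + m → 1 ≤ b → SignedCopartitionCount (a + m) b n) →
        ∀ b → 1 ≤ a → 1 ≤ b → SignedCopartitionCount a b n
      ground-step a a≤n larger b 1≤a 1≤b = signedCount-ground-step 1≤a 1≤b a≤n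
        (larger b (1≤+m 1≤a) 1≤b) (smaller (ℕ.∸-monoʳ-< 1≤a a≤n) a (b + m) 1≤a (1≤+m 1≤b))

corollary1 : (a b m : ℕ) → 1 ≤ a → 1 ≤ b → 1 ≤ m → (n : ℕ) →
    ∃₂ λ (ke ko : ℕ) → (Fin ke ↔ CPe a b m n) × (Fin ko ↔ CPo a b m n) ×
      ((+ ke) - (+ ko) ≡ rhsSeries a b m n)
corollary1 a b m 1≤a 1≤b 1≤m n =
  SignedCount-↔ (↔-sym (CP↔Copartitions (GroundParity-irrelevant 0)))
                (↔-sym (CP↔Copartitions (GroundParity-irrelevant 1)))
    (signedCount n a b 1≤a 1≤b)
  where
  instance
    m≢0 : NonZero m
    m≢0 = >-nonZero 1≤m
  open Copartitions m
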